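{- Let $G$ be a finite simple graph. If the $2$-shunt intersection graph $A_2(G)$ has the same number of vertices as $G$, then the minimum degree of $G$ satisfies $\delta(G)\le 2$.
   Context: A $2$-arc on distinct vertices is a sequence $(x,u,y)$ of pairwise distinct vertices with $xu,uy\in E(G)$; it can be shunted onto $(u,y,z)$ if $x,u,y,z$ are pairwise distinct and $yz\in E(G)$. $A_2(G)$ has as vertices the $2$-arcs on distinct vertices that can be shunted onto some other $2$-arc on distinct vertices; two distinct vertices are adjacent iff the corresponding $2$-arcs share a vertex of $G$. -}

module Defs where

open import Data.Nat using (ℕ)
open import Data.Bool using (Bool; true; false; _∧_; not; if_then_else_)
open import Data.Fin using (Fin; _≟_)
open import Data.List using (List; length; filterᵇ; allFin; concatMap)
open import Data.Bool.ListAction using (any)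
open import Data.Product using (_×_; _,_)
open import Relation.Nullary.Decidable using (⌊_⌋)
open import Relation.Binary.PropositionalEquality using (_≡_)

record Graph (n : ℕ) : Set where
  field
    adj    : Fin n → Fin n → Bool
    sym    : ∀ x y → adj x y ≡ adj y x
    irrefl : ∀ x → adj x x ≡ false
open Graph public

_≠ᵇ_ : ∀ {n} → Fin n → Fin n → Bool
x ≠ᵇ y = not ⌊ x ≟ y ⌋

degree : ∀ {n} → Graph n → Fin n → ℕ
degree {n} G v = length (filterᵇ (adj G v) (allFin n))

is2Arc : ∀ {n} → Graph n → Fin n → Fin n → Fin n → Bool
is2Arc G x u y =
  (x ≠ᵇ u) ∧ (u ≠ᵇ y) ∧ (x ≠ᵇ y) ∧ adj G x u ∧ adj G u y

shuntsOnto : ∀ {n} → Graph n → Fin n → Fin n → Fin n → Fin n → Bool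
shuntsOnto G x u y z =
  is2Arc G x u y ∧ (z ≠ᵇ x) ∧ (z ≠ᵇ u) ∧ (z ≠ᵇ y) ∧ adj G y z

-- (x , u , y) is a vertex of A₂(G): a 2-arc on distinct vertices that
-- can be shunted onto some other 2-arc on distinct vertices
isA₂Vertex : ∀ {n} → Graph n → Fin n × Fin n × Fin n → Bool
isA₂Vertex {n} G (x , u , y) = any (shuntsOnto G x u y) (allFin n)

triples : ∀ n → List (Fin n × Fin n × Fin n)
triples n = concatMap (λ x → concatMap (λ u → Data.List.map (λ y → (x , u , y)) (allFin n)) (allFin n)) (allFin n)

numVerticesA₂ : ∀ {n} → Graph n → ℕ
numVerticesA₂ {n} G = length (filterᵇ (isA₂Vertex G) (triples n))

-- minimum degree δ(G) ≤ k  (for a graph with at least one vertex):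
-- some vertex has degree at most k
minDegree≤ : ∀ {n} → Graph n → ℕ → Set
minDegree≤ {n} G k = Data.Product.∃ λ (v : Fin n) → degree G v Data.Nat.≤ k

{-# OPTIONS --safe #-}
module Submission where

-- If every vertex has degree at least 3, then every arc (x , u) extends to a
-- vertex (x , u , y) of A₂(G): pick a neighbour y ≠ x of u and then a
-- neighbour z ∉ {x , u} of y, onto whose 2-arc (u , y , z) it shunts.  These
-- vertices are distinct for distinct arcs, so A₂(G) has at least
-- Σ deg ≥ 3n > n vertices.

open import Defs hiding (sym)
open import Data.Bool using (Bool; true; false; T; _∧_)
open import Data.Bool.Properties using (T-∧; T?)
open import Data.Fin using (Fin; _≟_)
open import Data.Fin.Properties using (any?)
open import Data.List using (List; []; _∷_; _++_; length; filterᵇ; allFin; concatMap; map)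
open import Data.List.Properties using (filter-++; length-++; filter-some; length-tabulate)
open import Data.List.Membership.Propositional using (_∈_; lose)
open import Data.List.Membership.Propositional.Properties using (∈-filter⁻; ∈-allFin)
open import Data.List.Relation.Unary.All as All using (All)
open import Data.List.Relation.Unary.Any using (here; there)
open import Data.List.Relation.Unary.Any.Properties using (any⁺; map⁺)
open import Data.List.Relation.Unary.Unique.Propositional using (Unique; _∷_)
open import Data.List.Relation.Unary.Unique.Propositional.Properties using (allFin⁺; filter⁺)
open import Data.Nat using (ℕ; _+_; _*_; _≤_; _≤?_; z≤n; s≤s; >-nonZero)
open import Data.Nat.ListAction using (sum)
open import Data.Nat.Properties using (≤-trans; +-mono-≤; m≤n+m; ≰⇒>; <⇒≱; m<m*n; module ≤-Reasoning)
open import Data.Product using (∃; _×_; _,_; proj₂)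
open import Function using (_∘_; id; Equivalence)
open import Relation.Binary using (DecidableEquality)
open import Relation.Binary.PropositionalEquality using (_≡_; _≢_; refl; sym; trans; cong; subst)
open import Relation.Nullary using (¬_; yes; no; contradiction)
open import Relation.Nullary.Decidable using (fromWitnessFalse)

private variable A B : Set

countᵇ : (A → Bool) → List A → ℕ
countᵇ p xs = length (filterᵇ p xs)

countᵇ-++ : (p : A → Bool) (xs ys : List A) → countᵇ p (xs ++ ys) ≡ countᵇ p xs + countᵇ p ys
countᵇ-++ p xs ys = trans (cong length (filter-++ (T? ∘ p) xs ys)) (length-++ (filterᵇ p xs))

countᵇ-concatMap : (p : B → Bool) (g : A → List B) (xs : List A) →
                   countᵇ p (concatMap g xs) ≡ sum (map (countᵇ p ∘ g) xs)
countᵇ-concatMap p g []       = refl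
countᵇ-concatMap p g (x ∷ xs) =
  trans (countᵇ-++ p (g x) (concatMap g xs)) (cong (countᵇ p (g x) +_) (countᵇ-concatMap p g xs))

countᵇ-≤-sum : (p : A → Bool) (f : A → ℕ) → (∀ a → T (p a) → 1 ≤ f a) →
               (xs : List A) → countᵇ p xs ≤ sum (map f xs)
countᵇ-≤-sum p f p⇒1≤f []       = z≤n
countᵇ-≤-sum p f p⇒1≤f (x ∷ xs) with p x | p⇒1≤f x
... | true  | 1≤fx = +-mono-≤ (1≤fx _) (countᵇ-≤-sum p f p⇒1≤f xs)
... | false | _    = ≤-trans (countᵇ-≤-sum p f p⇒1≤f xs) (m≤n+m _ (f x))

length-*-≤-sum : (k : ℕ) (f : A → ℕ) → (∀ a → k ≤ f a) →
                 (xs : List A) → length xs * k ≤ sum (map f xs)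
length-*-≤-sum k f k≤f []       = z≤n
length-*-≤-sum k f k≤f (x ∷ xs) = +-mono-≤ (k≤f x) (length-*-≤-sum k f k≤f xs)

module _ (_≟ᴬ_ : DecidableEquality A) where

  unique-∃-≢ : ∀ {xs} (c : A) → Unique xs → 2 ≤ length xs → ∃ λ w → w ∈ xs × w ≢ c
  unique-∃-≢ {x ∷ y ∷ _} c ((x≢y All.∷ _) ∷ _) (s≤s (s≤s _)) with x ≟ᴬ c
  ... | no x≢c  = x , here refl , x≢c
  ... | yes refl = y , there (here refl) , x≢y ∘ sym

  unique-∃-≢₂ : ∀ {xs} (a b : A) → Unique xs → 3 ≤ length xs → ∃ λ w → w ∈ xs × w ≢ a × w ≢ b
  unique-∃-≢₂ {x ∷ ys} a b (x≢ys ∷ ys!) (s≤s 2≤|ys|) with x ≟ᴬ a | x ≟ᴬ b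
  ... | no x≢a | no x≢b = x , here refl , x≢a , x≢b
  ... | yes refl | _ =
    let w , w∈ys , w≢b = unique-∃-≢ b ys! 2≤|ys| in w , there w∈ys , All.lookup x≢ys w∈ys ∘ sym , w≢b
  ... | no x≢a | yes refl =
    let w , w∈ys , w≢a = unique-∃-≢ a ys! 2≤|ys| in w , there w∈ys , w≢a , All.lookup x≢ys w∈ys ∘ sym

triplesFrom : ∀ {n} → Fin n → List (Fin n × Fin n × Fin n)
triplesFrom {n} x = concatMap (λ u → map (λ y → (x , u , y)) (allFin n)) (allFin n)

module _ {n : ℕ} (G : Graph n) where

  adj⇒≢ : ∀ {x y} → T (adj G x y) → x ≢ y
  adj⇒≢ {x} x~x refl = subst T (irrefl G x) x~x

  ∃-neighbour-≢₂ : ∀ {v} → 3 ≤ degree G v → (a b : Fin n) →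
                   ∃ λ w → T (adj G v w) × w ≢ a × w ≢ b
  ∃-neighbour-≢₂ {v} 3≤deg a b =
    let w , w∈N , w≢a , w≢b = unique-∃-≢₂ _≟_ a b neighbours-unique 3≤deg
    in  w , proj₂ (∈-filter⁻ (T? ∘ adj G v) {xs = allFin n} w∈N) , w≢a , w≢b
    where
    neighbours-unique : Unique (filterᵇ (adj G v) (allFin n))
    neighbours-unique = filter⁺ (T? ∘ adj G v) {allFin n} (allFin⁺ n)

  shuntsOnto-intro : ∀ {x u y z} → T (adj G x u) → T (adj G u y) → T (adj G y z) →
                     x ≢ y → z ≢ x → z ≢ u → T (shuntsOnto G x u y z)
  shuntsOnto-intro x~u u~y y~z x≢y z≢x z≢u =
    (≠ (adj⇒≢ x~u) & ≠ (adj⇒≢ u~y) & ≠ x≢y & x~u & u~y) &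
    ≠ z≢x & ≠ z≢u & ≠ (adj⇒≢ y~z ∘ sym) & y~z
    where
    infixr 6 _&_
    _&_ : ∀ {a b} → T a → T b → T (a ∧ b)
    p & q = Equivalence.from T-∧ (p , q)
    ≠ : ∀ {i j : Fin n} → i ≢ j → T (i ≠ᵇ j)
    ≠ = fromWitnessFalse

module _ {n : ℕ} (G : Graph n) (δ≥3 : ∀ v → 3 ≤ degree G v) where

  arc-extends-to-A₂Vertex : ∀ {x u} → T (adj G x u) → ∃ λ y → T (isA₂Vertex G (x , u , y))
  arc-extends-to-A₂Vertex {x} {u} x~u =
    let y , u~y , y≢x , _   = ∃-neighbour-≢₂ G (δ≥3 u) x x
        z , y~z , z≢x , z≢u = ∃-neighbour-≢₂ G (δ≥3 y) x u
    in  y , any⁺ (shuntsOnto G x u y) (lose (∈-allFin z)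
              (shuntsOnto-intro G x~u u~y y~z (y≢x ∘ sym) z≢x z≢u))

  degree≤countᵇ-A₂Vertex-from : ∀ x → degree G x ≤ countᵇ (isA₂Vertex G) (triplesFrom x)
  degree≤countᵇ-A₂Vertex-from x = begin
    degree G x
      ≤⟨ countᵇ-≤-sum (adj G x) _ arc⇒1≤ (allFin n) ⟩
    sum (map (countᵇ (isA₂Vertex G) ∘ triplesThrough) (allFin n))
      ≡⟨ countᵇ-concatMap (isA₂Vertex G) triplesThrough (allFin n) ⟨
    countᵇ (isA₂Vertex G) (triplesFrom x)
      ∎
    where
    open ≤-Reasoning
    triplesThrough : Fin n → List (Fin n × Fin n × Fin n)
    triplesThrough u = map (λ y → (x , u , y)) (allFin n)
    arc⇒1≤ : ∀ u → T (adj G x u) → 1 ≤ countᵇ (isA₂Vertex G) (triplesThrough u)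
    arc⇒1≤ u x~u =
      let y , a₂ = arc-extends-to-A₂Vertex x~u
      in  filter-some (T? ∘ isA₂Vertex G) (map⁺ (lose (∈-allFin y) a₂))

  n*3≤numVerticesA₂ : n * 3 ≤ numVerticesA₂ G
  n*3≤numVerticesA₂ = begin
    n * 3
      ≡⟨ cong (_* 3) (length-tabulate {n = n} id) ⟨
    length (allFin n) * 3
      ≤⟨ length-*-≤-sum 3 _ 3≤row (allFin n) ⟩
    sum (map (countᵇ (isA₂Vertex G) ∘ triplesFrom) (allFin n))
      ≡⟨ countᵇ-concatMap (isA₂Vertex G) triplesFrom (allFin n) ⟨
    numVerticesA₂ G
      ∎
    where
    open ≤-Reasoning
    3≤row : ∀ x → 3 ≤ countᵇ (isA₂Vertex G) (triplesFrom x)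
    3≤row x = ≤-trans (δ≥3 x) (degree≤countᵇ-A₂Vertex-from x)

mainTheorem16 : (n : ℕ) → 1 ≤ n → (G : Graph n) →
                numVerticesA₂ G ≡ n → minDegree≤ G 2
mainTheorem16 n 1≤n G |A₂|≡n with any? (λ v → degree G v ≤? 2)
... | yes δ≤2 = δ≤2
... | no  δ≰2 = contradiction (subst (n * 3 ≤_) |A₂|≡n (n*3≤numVerticesA₂ G δ≥3)) n≱n*3
  where
  δ≥3 : ∀ v → 3 ≤ degree G v
  δ≥3 v = ≰⇒> (δ≰2 ∘ (v ,_))
  n≱n*3 : ¬ n * 3 ≤ n
  n≱n*3 = <⇒≱ (m<m*n n 3 {{>-nonZero 1≤n}} (s≤s (s≤s z≤n)))
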